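{- Let $T$ be a finite decomposition semigroup with a unit (neutral element) $1$. For $u\in T$ the following are equivalent: (i) $u$ is right invertible (there is $v\in T$ with $uv=1$); (ii) $u$ is left invertible (there is $v\in T$ with $vu=1$); (iii) $u$ is cyclic, i.e. there exists an integer $p\geq1$ with $u^p=1$ (and hence $u$ is invertible).
   Context: A semigroup $T$ is a finite decomposition semigroup if for every $t\in T$ the set of pairs $(t_1,t_2)\in T\times T$ with $t_1t_2=t$ is finite. -}

module Defs where

open import Level using (Level; _⊔_)
open import Data.Nat using (ℕ; zero; suc)
open import Data.Product using (Σ; ∃; _×_; _,_)
open import Data.List using (List)
open import Data.List.Relation.Unary.Any using (Any)
open import Algebra.Bundles using (Semigroup; Monoid)

FiniteDecomposition : ∀ {c ℓ} → Semigroup c ℓ → Set (c ⊔ ℓ)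
FiniteDecomposition S =
  ∀ (t : Carrier) → ∃ λ (L : List (Carrier × Carrier)) →
    ∀ (t₁ t₂ : Carrier) → (t₁ ∙ t₂) ≈ t →
      Any (λ { (s₁ , s₂) → (t₁ ≈ s₁) × (t₂ ≈ s₂) }) L
  where open Semigroup S

module _ {c ℓ} (M : Monoid c ℓ) where
  open Monoid M
  pow : Carrier → ℕ → Carrier
  pow u zero    = ε
  pow u (suc p) = u ∙ pow u p

-- If u ∙ v ≈ 1 then uⁿ ∙ vⁿ ≈ 1 for every n, so the pairs (uⁿ , vⁿ) are
-- infinitely many factorisations of 1. By finite decomposition two of them
-- coincide, uⁱ ≈ uʲ with i < j, and cancelling the right-invertible uⁱ gives
-- uʲ⁻ⁱ ≈ 1. A cyclic element is invertible on both sides, and a left inverse v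
-- of u is right invertible, hence cyclic, hence has a left inverse, which must
-- then be u itself.
module Submission where

open import Defs
open import Level using (_⊔_)
open import Algebra.Bundles using (Semigroup; Monoid)
open import Data.Nat using (ℕ; zero; suc; _+_; _∸_; _<_; _≥_)
open import Data.Nat.Properties using (n<1+n; <⇒≤; m<n⇒0<n∸m; m∸n+n≡m)
open import Data.Fin as Fin using (Fin; toℕ)
open import Data.Fin.Properties using (pigeonhole)
open import Data.List using (List; length; lookup)
open import Data.List.Relation.Unary.Any using (index)
open import Data.List.Relation.Unary.Any.Properties using (lookup-index)
open import Data.Product using (∃; ∃₂; _×_; _,_; proj₁; proj₂)
open import Relation.Binary.PropositionalEquality as ≡ using (_≡_; cong; subst)
open import Function using (_∘_)

module _ {c ℓ} (S : Semigroup c ℓ) (fd : FiniteDecomposition S) where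
  open Semigroup S

  factorisations-repeat : ∀ t (a b : ℕ → Carrier) → (∀ n → a n ∙ b n ≈ t) →
                          ∃₂ λ i j → i < j × a i ≈ a j × b i ≈ b j
  factorisations-repeat t a b ab≈t = repeat (pigeonhole (n<1+n (length L)) position)
    where
    L : List (Carrier × Carrier)
    L = proj₁ (fd t)

    position : Fin (suc (length L)) → Fin (length L)
    position k = index (proj₂ (fd t) (a (toℕ k)) (b (toℕ k)) (ab≈t (toℕ k)))

    ListedAt : ℕ → Fin (length L) → Set ℓ
    ListedAt n x = a n ≈ proj₁ (lookup L x) × b n ≈ proj₂ (lookup L x)

    listedAt-position : ∀ k → ListedAt (toℕ k) (position k)
    listedAt-position k = lookup-index (proj₂ (fd t) (a (toℕ k)) (b (toℕ k)) (ab≈t (toℕ k)))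

    repeat : (∃₂ λ i j → i Fin.< j × position i ≡ position j) →
             ∃₂ λ i j → i < j × a i ≈ a j × b i ≈ b j
    repeat (i , j , i<j , same-position)
      with aᵢ≈ , bᵢ≈ ← listedAt-position i
         | aⱼ≈ , bⱼ≈ ← subst (ListedAt (toℕ j)) (≡.sym same-position) (listedAt-position j)
      = toℕ i , toℕ j , i<j , trans aᵢ≈ (sym aⱼ≈) , trans bᵢ≈ (sym bⱼ≈)

module Invertibility {c ℓ} (M : Monoid c ℓ) where
  open Monoid M
  open import Algebra.Properties.Monoid M using (cancelᶜ; cancelˡ; insertʳ; elimʳ)
  open import Relation.Binary.Reasoning.Setoid setoid

  infixr 8 _^_
  _^_ : Carrier → ℕ → Carrier
  _^_ = pow M

  RightInvertible LeftInvertible : Carrier → Set (c ⊔ ℓ)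
  RightInvertible u = ∃ λ v → u ∙ v ≈ ε
  LeftInvertible  u = ∃ λ v → v ∙ u ≈ ε

  Cyclic : Carrier → Set ℓ
  Cyclic u = ∃ λ p → p ≥ 1 × u ^ p ≈ ε

  ^-+ : ∀ u m n → u ^ (m + n) ≈ u ^ m ∙ u ^ n
  ^-+ u zero    n = sym (identityˡ (u ^ n))
  ^-+ u (suc m) n = begin
    u ∙ u ^ (m + n)       ≈⟨ ∙-congˡ (^-+ u m n) ⟩
    u ∙ (u ^ m ∙ u ^ n)   ≈⟨ assoc u (u ^ m) (u ^ n) ⟨
    (u ∙ u ^ m) ∙ u ^ n   ∎

  ^-comm : ∀ u n → u ^ n ∙ u ≈ u ∙ u ^ n
  ^-comm u zero    = trans (identityˡ u) (sym (identityʳ u))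
  ^-comm u (suc n) = trans (assoc u (u ^ n) u) (∙-congˡ (^-comm u n))

  ^-inverse : ∀ {u v} → u ∙ v ≈ ε → ∀ n → u ^ n ∙ v ^ n ≈ ε
  ^-inverse uv≈ε zero = identityˡ ε
  ^-inverse {u} {v} uv≈ε (suc n) = begin
    (u ∙ u ^ n) ∙ (v ∙ v ^ n)   ≈⟨ ∙-congʳ (^-comm u n) ⟨
    (u ^ n ∙ u) ∙ (v ∙ v ^ n)   ≈⟨ cancelᶜ uv≈ε (u ^ n) (v ^ n) ⟩
    u ^ n ∙ v ^ n               ≈⟨ ^-inverse uv≈ε n ⟩
    ε                           ∎

  fixes-right-invertible⇒≈ε : ∀ {a w b} → a ∙ w ≈ ε → b ∙ a ≈ a → b ≈ ε
  fixes-right-invertible⇒≈ε {a} {w} {b} aw≈ε ba≈a = begin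
    b             ≈⟨ insertʳ aw≈ε b ⟩
    (b ∙ a) ∙ w   ≈⟨ ∙-congʳ ba≈a ⟩
    a ∙ w         ≈⟨ aw≈ε ⟩
    ε             ∎

  inverses-agree : ∀ {w v u} → w ∙ v ≈ ε → v ∙ u ≈ ε → w ≈ u
  inverses-agree {w} {u = u} wv≈ε vu≈ε =
    trans (sym (elimʳ vu≈ε w)) (cancelˡ wv≈ε u)

  cyclic⇒rightInvertible : ∀ {u} → Cyclic u → RightInvertible u
  cyclic⇒rightInvertible {u} (suc p , _ , uᵖ⁺¹≈ε) = u ^ p , uᵖ⁺¹≈ε

  cyclic⇒leftInvertible : ∀ {u} → Cyclic u → LeftInvertible u
  cyclic⇒leftInvertible {u} (suc p , _ , uᵖ⁺¹≈ε) = u ^ p , trans (^-comm u p) uᵖ⁺¹≈ε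

module _ {c ℓ} (T : Monoid c ℓ) (fd : FiniteDecomposition (Monoid.semigroup T)) where
  open Monoid T
  open Invertibility T
  open import Relation.Binary.Reasoning.Setoid setoid

  rightInvertible⇒cyclic : ∀ {u} → RightInvertible u → Cyclic u
  rightInvertible⇒cyclic {u} (v , uv≈ε)
    with i , j , i<j , uⁱ≈uʲ , _ ←
         factorisations-repeat semigroup fd ε (u ^_) (v ^_) (^-inverse uv≈ε)
    = j ∸ i , m<n⇒0<n∸m i<j
    , fixes-right-invertible⇒≈ε (^-inverse uv≈ε i) uʲ⁻ⁱuⁱ≈uⁱ
    where
    uʲ⁻ⁱuⁱ≈uⁱ : u ^ (j ∸ i) ∙ u ^ i ≈ u ^ i
    uʲ⁻ⁱuⁱ≈uⁱ = begin
      u ^ (j ∸ i) ∙ u ^ i   ≈⟨ ^-+ u (j ∸ i) i ⟨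
      u ^ (j ∸ i + i)       ≡⟨ cong (u ^_) (m∸n+n≡m (<⇒≤ i<j)) ⟩
      u ^ j                 ≈⟨ uⁱ≈uʲ ⟨
      u ^ i                 ∎

  leftInvertible⇒rightInvertible : ∀ {u} → LeftInvertible u → RightInvertible u
  leftInvertible⇒rightInvertible {u} (v , vu≈ε)
    with w , wv≈ε ← cyclic⇒leftInvertible (rightInvertible⇒cyclic (u , vu≈ε))
    = v , trans (∙-congʳ (sym (inverses-agree wv≈ε vu≈ε))) wv≈ε

lemma1 : ∀ {c ℓ} (T : Monoid c ℓ) → FiniteDecomposition (Monoid.semigroup T) →
    (u : Monoid.Carrier T) →
      ((∃ λ v → Monoid._≈_ T (Monoid._∙_ T u v) (Monoid.ε T)) →
          (∃ λ v → Monoid._≈_ T (Monoid._∙_ T v u) (Monoid.ε T)))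
      × ((∃ λ v → Monoid._≈_ T (Monoid._∙_ T v u) (Monoid.ε T)) →
          (∃ λ v → Monoid._≈_ T (Monoid._∙_ T u v) (Monoid.ε T)))
      × ((∃ λ v → Monoid._≈_ T (Monoid._∙_ T u v) (Monoid.ε T)) →
          (∃ λ (p : ℕ) → (p ≥ 1) × Monoid._≈_ T (pow T u p) (Monoid.ε T)))
      × ((∃ λ (p : ℕ) → (p ≥ 1) × Monoid._≈_ T (pow T u p) (Monoid.ε T)) →
          (∃ λ v → Monoid._≈_ T (Monoid._∙_ T u v) (Monoid.ε T)))
lemma1 T fd _ =
    cyclic⇒leftInvertible ∘ rightInvertible⇒cyclic T fd
  , leftInvertible⇒rightInvertible T fd
  , rightInvertible⇒cyclic T fd
  , cyclic⇒rightInvertible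
  where open Invertibility T
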